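{- Let $T$ be a finite tree and $M$ a maximum matching of $T$. Then $M\cap\operatorname{ConnE}(T)=\emptyset$.
   Context: $\mathcal{N}(T)$ is the null space of the adjacency matrix of $T$; $\operatorname{Supp}(T)=\{v: x_v\neq 0\text{ for some }x\in\mathcal{N}(T)\}$. For $X\subseteq V(T)$, $N[X]=\bigcup_{u\in X}(N(u)\cup\{u\})$. $\mathcal{F}_{S}(T)$ is the set of connected components of the induced subgraph $T\langle N[\operatorname{Supp}(T)]\rangle$, and $\mathcal{F}_{N}(T)$ is the set of connected components of the forest obtained from $T$ by deleting the vertices of $N[\operatorname{Supp}(T)]$. $\operatorname{ConnE}(T)$ is the set of edges of $T$ that are edges of no tree in $\mathcal{F}_{S}(T)$ and of no tree in $\mathcal{F}_{N}(T)$ (connection edges). -}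

module Defs where

open import Data.Nat using (ℕ; zero; suc; _≤_; _<_; _<ᵇ_) renaming (_+_ to _+ℕ_)
open import Data.Fin using (Fin; toℕ) renaming (zero to fzero; suc to fsuc)
open import Data.Bool using (Bool; true; false; T; if_then_else_; _∧_)
open import Data.Rational using (ℚ; 0ℚ; 1ℚ; _+_; _*_)
open import Data.Product using (Σ; ∃; _×_; _,_)
open import Data.Sum using (_⊎_)
open import Data.Unit using (⊤)
open import Data.List using (List; []; _∷_; _++_; length)
open import Data.List.Relation.Unary.Linked using (Linked)
open import Data.List.Relation.Unary.Unique.Propositional using (Unique)
open import Relation.Nullary using (¬_)
open import Relation.Binary.PropositionalEquality using (_≡_; _≢_)

record SimpleGraph (n : ℕ) : Set where
  field
    adj        : Fin n → Fin n → Bool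
    adj-sym    : ∀ u v → adj u v ≡ adj v u
    adj-irrefl : ∀ v → adj v v ≡ false
open SimpleGraph public

module _ {n : ℕ} (G : SimpleGraph n) where

  Adj : Fin n → Fin n → Set
  Adj u v = T (adj G u v)

  -- walks all of whose vertices satisfy P (i.e. walks in the induced subgraph on P)
  data WalkIn (P : Fin n → Set) : Fin n → Fin n → Set where
    here : ∀ {u} → P u → WalkIn P u u
    step : ∀ {u v w} → P u → Adj u v → WalkIn P v w → WalkIn P u w

  Connected : Set
  Connected = ∀ u v → WalkIn (λ _ → ⊤) u v

  -- a cycle v ∷ vs (≥ 3 distinct vertices, consecutive adjacent, last adjacent to v)
  Acyclic : Set
  Acyclic = ∀ v vs → 2 ≤ length vs → Unique (v ∷ vs) →
            ¬ Linked Adj (v ∷ vs ++ v ∷ [])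

  IsTree : Set
  IsTree = (0 < n) × Connected × Acyclic

sumℚ : ∀ {n} → (Fin n → ℚ) → ℚ
sumℚ {zero}  f = 0ℚ
sumℚ {suc n} f = f fzero + sumℚ (λ i → f (fsuc i))

sumℕ : ∀ {n} → (Fin n → ℕ) → ℕ
sumℕ {zero}  f = 0
sumℕ {suc n} f = f fzero +ℕ sumℕ (λ i → f (fsuc i))

module _ {n : ℕ} (G : SimpleGraph n) where

  adjMatrix : Fin n → Fin n → ℚ
  adjMatrix i j = if adj G i j then 1ℚ else 0ℚ

  InNullSpace : (Fin n → ℚ) → Set
  InNullSpace x = ∀ i → sumℚ (λ j → adjMatrix i j * x j) ≡ 0ℚ

  Supp : Fin n → Set
  Supp v = ∃ λ (x : Fin n → ℚ) → InNullSpace x × x v ≢ 0ℚ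

  ClosedNbhd : (Fin n → Set) → Fin n → Set
  ClosedNbhd X u = X u ⊎ (∃ λ w → X w × Adj G w u)

  NSupp : Fin n → Set
  NSupp = ClosedNbhd Supp

  -- uv is an edge of some connected component (with root r) of the induced subgraph on P
  EdgeOfSomeComponent : (Fin n → Set) → Fin n → Fin n → Set
  EdgeOfSomeComponent P u v =
    ∃ λ r → P r × WalkIn G P r u × WalkIn G P r v × Adj G u v

  EdgeOfFS : Fin n → Fin n → Set
  EdgeOfFS = EdgeOfSomeComponent NSupp

  EdgeOfFN : Fin n → Fin n → Set
  EdgeOfFN = EdgeOfSomeComponent (λ w → ¬ NSupp w)

  ConnE : Fin n → Fin n → Set
  ConnE u v = Adj G u v × ¬ EdgeOfFS u v × ¬ EdgeOfFN u v

  record IsMatching (M : Fin n → Fin n → Bool) : Set where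
    field
      sub  : ∀ u v → T (M u v) → Adj G u v
      sym  : ∀ u v → M u v ≡ M v u
      disj : ∀ u v w → T (M u v) → T (M u w) → v ≡ w

  matchingSize : (Fin n → Fin n → Bool) → ℕ
  matchingSize M = sumℕ (λ u → sumℕ (λ v →
    if M u v ∧ (toℕ u <ᵇ toℕ v) then 1 else 0))

  IsMaximumMatching : (Fin n → Fin n → Bool) → Set
  IsMaximumMatching M = IsMatching M ×
    (∀ M' → IsMatching M' → matchingSize M' ≤ matchingSize M)

module Submission where

-- It suffices that N[Supp T] is closed under M-partners (matched-closure):
-- then for uv ∈ M either both ends lie in N[Supp T], so uv is an edge of a
-- tree of 𝓕_S, or neither does, so uv is an edge of a tree of 𝓕_N.  If a ∈ Supp
-- its partner b is a neighbour of Supp; if a is adjacent to some w ∈ Supp with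
-- w ≠ b, then b ∈ Supp itself (SupportTransfer).  That rests on two facts
-- about a tree rooted at r and a matching N:
--   * PathFlip: exchanging N along an alternating path from r to an exposed
--     vertex augments N when r is exposed, and otherwise moves the exposed
--     vertex to r without changing the size;
--   * ExposedRoot: if a maximum matching leaves r exposed then r ∈ Supp, the
--     null vector being ±1 on the even vertices of the alternating paths
--     from r (odd vertices are matched, by maximality and PathFlip).

open import Defs
open import Level using (Level)
open import Function using (_∘_; _$_)
open import Algebra.Bundles using (CommutativeMonoid)
import Algebra.Properties.CommutativeMonoid.Sum as MonoidSum
open import Data.Nat using (ℕ; zero; suc; _+_; _*_; _≤_; _<_; _<ᵇ_; _⊔_; z≤n; s≤s)
import Data.Nat.Properties as ℕP
open import Data.Fin using (Fin; toℕ) renaming (zero to fzero; suc to fsuc)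
open import Data.Fin.Properties using (suc-injective; toℕ-injective; any?) renaming (_≟_ to _≟F_)
open import Data.Rational using (ℚ; 0ℚ; 1ℚ) renaming (_+_ to _+ℚ_; _*_ to _*ℚ_; -_ to -ℚ_)
import Data.Rational.Properties as ℚP
open import Data.Bool using (Bool; true; false; T; not; if_then_else_; _∧_; _∨_; _xor_)
open import Data.Bool.Properties using (xor-same; xor-identityʳ)
open import Data.Product using (Σ; ∃; _×_; _,_; proj₁; proj₂)
open import Data.Sum using (_⊎_; inj₁; inj₂; [_,_]′; map₂)
open import Data.Unit using (tt)
open import Data.Empty using (⊥; ⊥-elim)
open import Data.List using (List; []; _∷_; _++_; length)
open import Data.List.Properties using (length-++-≤ʳ)
open import Data.List.Relation.Unary.All using (All; []; _∷_) renaming (map to all-map)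
open import Data.List.Relation.Unary.All.Properties using () renaming (++⁺ to all-++)
open import Data.List.Relation.Unary.AllPairs using ([]; _∷_)
open import Data.List.Relation.Unary.Linked using (Linked; []; [-]; _∷_)
open import Data.List.Relation.Unary.Unique.Propositional using (Unique)
open import Relation.Binary using (tri<; tri≈; tri>)
open import Relation.Unary using (Decidable)
open import Relation.Nullary using (¬_; Dec; does; yes; no; contradiction)
open import Relation.Nullary.Decidable using (dec-true; dec-false; ¬?; T?; _×-dec_; _⊎-dec_)
open import Relation.Binary.PropositionalEquality
  using (_≡_; _≢_; refl; sym; trans; cong; cong₂; subst; module ≡-Reasoning)

T⇒≡true : ∀ {b} → T b → b ≡ true
T⇒≡true {true} _ = refl

¬T⇒≡false : ∀ {b} → ¬ T b → b ≡ false
¬T⇒≡false {true}  ¬tb = contradiction tt ¬tb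
¬T⇒≡false {false} _   = refl

does-sound : ∀ {a} {A : Set a} (a? : Dec A) → T (does a?) → A
does-sound (yes a) _ = a

count : Bool → ℕ
count b = if b then 1 else 0

δ : ∀ {n} → Fin n → Fin n → Bool
δ j p = does (j ≟F p)

δ-self : ∀ {n} (p : Fin n) → δ p p ≡ true
δ-self p = dec-true (p ≟F p) refl

δ-other : ∀ {n} {j p : Fin n} → j ≢ p → δ j p ≡ false
δ-other {j = j} {p} = dec-false (j ≟F p)

δ-sound : ∀ {n} {j p : Fin n} → T (δ j p) → j ≡ p
δ-sound {j = j} {p} = does-sound (j ≟F p)

-- exchanging the partner of a vertex for its other path neighbour
xor-exchange : ∀ {n} {p d : Fin n} → p ≢ d → ∀ j → (δ j p xor (δ j p ∨ δ j d)) ≡ δ j d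
xor-exchange {p = p} {d} p≢d j with j ≟F p
... | yes refl = sym (δ-other p≢d)
... | no _     = refl

xor-exchange′ : ∀ {n} {p d : Fin n} → p ≢ d → ∀ j → (δ j d xor (δ j p ∨ δ j d)) ≡ δ j p
xor-exchange′ {p = p} {d} p≢d j with j ≟F p | j ≟F d
... | yes refl | yes refl = contradiction refl p≢d
... | yes refl | no _     = refl
... | no _     | yes refl = refl
... | no _     | no _     = refl

<ᵇ-exactly-one : ∀ m n → m ≢ n → count (m <ᵇ n) + count (n <ᵇ m) ≡ 1
<ᵇ-exactly-one zero    zero    m≢n = contradiction refl m≢n
<ᵇ-exactly-one zero    (suc n) _   = refl
<ᵇ-exactly-one (suc m) zero    _   = refl
<ᵇ-exactly-one (suc m) (suc n) m≢n = <ᵇ-exactly-one m n (m≢n ∘ cong suc)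

double-injective : ∀ a b → a + a ≡ b + b → a ≡ b
double-injective a b a+a≡b+b = ℕP.*-cancelˡ-≡ a b 2 (begin
  2 * a      ≡⟨ cong (a +_) (ℕP.+-identityʳ a) ⟩
  a + a      ≡⟨ a+a≡b+b ⟩
  b + b      ≡⟨ cong (b +_) (ℕP.+-identityʳ b) ⟨
  2 * b      ∎)
  where open ≡-Reasoning

leastWitness : ∀ {p} {P : ℕ → Set p} → Decidable P → ∀ {K} → P K →
               Σ ℕ λ k → P k × (∀ {j} → P j → k ≤ j)
leastWitness P? {zero} pK = 0 , pK , λ _ → z≤n
leastWitness {P = P} P? {suc K} pK with P? 0
... | yes p0 = 0 , p0 , λ _ → z≤n
... | no ¬p0 with leastWitness (λ j → P? (suc j)) pK
...   | k , pk , least = suc k , pk , below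
  where
  below : ∀ {j} → P j → suc k ≤ j
  below {zero}  p0 = contradiction p0 ¬p0
  below {suc j} pj = s≤s (least pj)

bound : ∀ {n} → (Fin n → ℕ) → ℕ
bound {zero}  f = 0
bound {suc n} f = f fzero ⊔ bound (f ∘ fsuc)

bound-≥ : ∀ {n} (f : Fin n → ℕ) i → f i ≤ bound f
bound-≥ f fzero    = ℕP.m≤m⊔n _ _
bound-≥ f (fsuc i) = ℕP.≤-trans (bound-≥ (f ∘ fsuc) i) (ℕP.m≤n⊔m _ _)

lastOf : ∀ {A : Set} → A → List A → A
lastOf x []       = x
lastOf x (y ∷ ys) = lastOf y ys

lastOf-snoc : ∀ {A : Set} (x : A) ys b → lastOf x (ys ++ b ∷ []) ≡ b
lastOf-snoc x []       b = refl
lastOf-snoc x (y ∷ ys) b = lastOf-snoc y ys b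

linked-snoc : ∀ {A : Set} {R : A → A → Set} {x xs b} →
              Linked R (x ∷ xs) → R (lastOf x xs) b → Linked R (x ∷ xs ++ b ∷ [])
linked-snoc {xs = []}     _           rb = rb ∷ [-]
linked-snoc {xs = y ∷ ys} (rxy ∷ rys) rb = rxy ∷ linked-snoc rys rb

module SparseSums {c ℓ : Level} (M : CommutativeMonoid c ℓ) where
  open CommutativeMonoid M
    using (Carrier; _≈_; _∙_; ε; ∙-cong; ∙-congˡ; identityˡ; identityʳ; comm; setoid)
  open MonoidSum M using (sum; sum-cong-≋; sum-replicate-zero)
  open import Relation.Binary.Reasoning.Setoid setoid

  sum-zero : ∀ {n} (t : Fin n → Carrier) → (∀ i → t i ≈ ε) → sum t ≈ ε
  sum-zero {n} t z = begin
    sum t              ≈⟨ sum-cong-≋ z ⟩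
    sum {n} (λ _ → ε)  ≈⟨ sum-replicate-zero n ⟩
    ε                  ∎

  sum-single : ∀ {n} (t : Fin n → Carrier) p → (∀ i → i ≢ p → t i ≈ ε) → sum t ≈ t p
  sum-single t fzero z = begin
    t fzero ∙ sum (t ∘ fsuc) ≈⟨ ∙-congˡ (sum-zero _ (λ i → z (fsuc i) λ ())) ⟩
    t fzero ∙ ε               ≈⟨ identityʳ _ ⟩
    t fzero                   ∎
  sum-single t (fsuc p) z = begin
    t fzero ∙ sum (t ∘ fsuc) ≈⟨ ∙-cong (z fzero λ ())
                                  (sum-single _ p (λ i i≢p → z (fsuc i) (i≢p ∘ suc-injective))) ⟩
    ε ∙ t (fsuc p)            ≈⟨ identityˡ _ ⟩
    t (fsuc p)                ∎

  sum-pair : ∀ {n} (t : Fin n → Carrier) p q → p ≢ q →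
             (∀ i → i ≢ p → i ≢ q → t i ≈ ε) → sum t ≈ t p ∙ t q
  sum-pair t fzero fzero p≢q z = contradiction refl p≢q
  sum-pair t fzero (fsuc q) p≢q z =
    ∙-congˡ (sum-single _ q (λ i i≢q → z (fsuc i) (λ ()) (i≢q ∘ suc-injective)))
  sum-pair t (fsuc p) fzero p≢q z = begin
    t fzero ∙ sum (t ∘ fsuc) ≈⟨ ∙-congˡ
                                  (sum-single _ p (λ i i≢p → z (fsuc i) (i≢p ∘ suc-injective) (λ ()))) ⟩
    t fzero ∙ t (fsuc p)      ≈⟨ comm _ _ ⟩
    t (fsuc p) ∙ t fzero      ∎
  sum-pair t (fsuc p) (fsuc q) p≢q z = begin
    t fzero ∙ sum (t ∘ fsuc)  ≈⟨ ∙-cong (z fzero (λ ()) (λ ()))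
                                   (sum-pair _ p q (p≢q ∘ cong fsuc)
                                     (λ i i≢p i≢q → z (fsuc i) (i≢p ∘ suc-injective) (i≢q ∘ suc-injective))) ⟩
    ε ∙ (t (fsuc p) ∙ t (fsuc q)) ≈⟨ identityˡ _ ⟩
    t (fsuc p) ∙ t (fsuc q)   ∎

module ℕΣ = MonoidSum ℕP.+-0-commutativeMonoid
module ℚΣ = MonoidSum ℚP.+-0-commutativeMonoid
module ℕSparse = SparseSums ℕP.+-0-commutativeMonoid
module ℚSparse = SparseSums ℚP.+-0-commutativeMonoid

sumℕ≡sum : ∀ {n} (f : Fin n → ℕ) → sumℕ f ≡ ℕΣ.sum f
sumℕ≡sum {zero}  f = refl
sumℕ≡sum {suc n} f = cong (f fzero +_) (sumℕ≡sum (f ∘ fsuc))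

sumℚ≡sum : ∀ {n} (f : Fin n → ℚ) → sumℚ f ≡ ℚΣ.sum f
sumℚ≡sum {zero}  f = refl
sumℚ≡sum {suc n} f = cong (f fzero +ℚ_) (sumℚ≡sum (f ∘ fsuc))

sum-δ : ∀ {n} (p : Fin n) → ℕΣ.sum (λ j → count (δ j p)) ≡ 1
sum-δ p = trans (ℕSparse.sum-single _ p (λ j j≢p → cong count (δ-other j≢p))) (cong count (δ-self p))

module _ {n : ℕ} (G : SimpleGraph n) where

  adj-sym′ : ∀ {u v} → Adj G u v → Adj G v u
  adj-sym′ {u} {v} = subst T (adj-sym G u v)

  adj⇒≢ : ∀ {u v} → Adj G u v → u ≢ v
  adj⇒≢ {u} a refl = subst T (adj-irrefl G u) a

  matched-sym : ∀ {M} → IsMatching G M → ∀ {u v} → T (M u v) → T (M v u)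
  matched-sym isM {u} {v} = subst T (IsMatching.sym isM u v)

module AdjacencyRows {n : ℕ} (G : SimpleGraph n) (x : Fin n → ℚ) where

  term : Fin n → Fin n → ℚ
  term s j = adjMatrix G s j *ℚ x j

  rowSum : Fin n → ℚ
  rowSum s = sumℚ (term s)

  private
    term-neighbour : ∀ {s j} → Adj G s j → adjMatrix G s j *ℚ x j ≡ x j
    term-neighbour {s} {j} a =
      trans (cong (λ e → (if e then 1ℚ else 0ℚ) *ℚ x j) (T⇒≡true a)) (ℚP.*-identityˡ (x j))

    term-vanish : ∀ s j → (Adj G s j → x j ≡ 0ℚ) → adjMatrix G s j *ℚ x j ≡ 0ℚ
    term-vanish s j vanish with adj G s j
    ... | true  = trans (ℚP.*-identityˡ (x j)) (vanish tt)
    ... | false = ℚP.*-zeroˡ (x j)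

  row-zero : ∀ s → (∀ j → Adj G s j → x j ≡ 0ℚ) → rowSum s ≡ 0ℚ
  row-zero s vanish = trans (sumℚ≡sum (term s)) (ℚSparse.sum-zero (term s) (λ j → term-vanish s j (vanish j)))

  row-single : ∀ {s p} → Adj G s p → (∀ j → j ≢ p → Adj G s j → x j ≡ 0ℚ) → rowSum s ≡ x p
  row-single {s} {p} a vanish =
    trans (sumℚ≡sum (term s))
          (trans (ℚSparse.sum-single (term s) p (λ j j≢p → term-vanish s j (vanish j j≢p))) (term-neighbour a))

  row-pair : ∀ {s p m} → p ≢ m → Adj G s p → Adj G s m →
             (∀ j → j ≢ p → j ≢ m → Adj G s j → x j ≡ 0ℚ) → rowSum s ≡ x p +ℚ x m
  row-pair {s} {p} {m} p≢m ap am vanish =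
    trans (sumℚ≡sum (term s))
          (trans (ℚSparse.sum-pair (term s) p m p≢m (λ j j≢p j≢m → term-vanish s j (vanish j j≢p j≢m)))
                 (cong₂ _+ℚ_ (term-neighbour ap) (term-neighbour am)))

degree : ∀ {n} → (Fin n → Fin n → Bool) → Fin n → ℕ
degree {n} M t = ℕΣ.sum {n} (λ j → count (M t j))

PartnerRow : ∀ {n} → (Fin n → Fin n → Bool) → Fin n → Fin n → Set
PartnerRow M t p = ∀ j → M t j ≡ δ j p

EmptyRow : ∀ {n} → (Fin n → Fin n → Bool) → Fin n → Set
EmptyRow M t = ∀ j → M t j ≡ false

module _ {n : ℕ} (M : Fin n → Fin n → Bool) (t : Fin n) where

  partner-unique : ∀ {p} → PartnerRow M t p → ∀ {j j′} → T (M t j) → T (M t j′) → j ≡ j′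
  partner-unique row {j} {j′} tj tj′ = trans (δ-sound (subst T (row j) tj)) (sym (δ-sound (subst T (row j′) tj′)))

  degree-partner : ∀ {p} → PartnerRow M t p → degree M t ≡ 1
  degree-partner {p} row = trans (ℕΣ.sum-cong-≗ {n} (λ j → cong count (row j))) (sum-δ p)

  degree-empty : EmptyRow M t → degree M t ≡ 0
  degree-empty row = trans (ℕΣ.sum-cong-≗ {n} (λ j → cong count (row j))) (ℕSparse.sum-zero {n} _ (λ _ → refl))

module Matchings {n : ℕ} (G : SimpleGraph n) where

  matched-row : ∀ {M} → IsMatching G M → ∀ {t p} → T (M t p) → PartnerRow M t p
  matched-row isM {t} {p} tp j with j ≟F p
  ... | yes refl = T⇒≡true tp
  ... | no j≢p  = ¬T⇒≡false (λ tj → j≢p (IsMatching.disj isM t j p tj tp))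

  exposed-row : ∀ {M : Fin n → Fin n → Bool} {t} → (∀ j → ¬ T (M t j)) → EmptyRow M t
  exposed-row ex j = ¬T⇒≡false (ex j)

  counted : (Fin n → Fin n → Bool) → Fin n → Fin n → ℕ
  counted M u v = if M u v ∧ (toℕ u <ᵇ toℕ v) then 1 else 0

  size≡sum : ∀ M → matchingSize G M ≡ ℕΣ.sum (λ u → ℕΣ.sum (counted M u))
  size≡sum M = trans (sumℕ≡sum (λ u → sumℕ (counted M u))) (ℕΣ.sum-cong-≗ {n} (λ u → sumℕ≡sum (counted M u)))

  count-split : ∀ {M} → IsMatching G M → ∀ u v → count (M u v) ≡ counted M u v + counted M v u
  count-split {M} isM u v rewrite IsMatching.sym isM v u with M u v in e
  ... | false = refl
  ... | true  = sym (<ᵇ-exactly-one (toℕ u) (toℕ v) (adj⇒≢ G (IsMatching.sub isM u v uv) ∘ toℕ-injective))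
    where
    uv : T (M u v)
    uv = subst T (sym e) tt

  handshake : ∀ {M} → IsMatching G M → matchingSize G M + matchingSize G M ≡ ℕΣ.sum (degree M)
  handshake {M} isM = sym $ begin
    ℕΣ.sum (degree M)
      ≡⟨ ℕΣ.sum-cong-≗ (λ u → ℕΣ.sum-cong-≗ (count-split isM u)) ⟩
    ℕΣ.sum (λ u → ℕΣ.sum (λ v → c u v + c v u))
      ≡⟨ ℕΣ.sum-cong-≗ (λ u → ℕΣ.∑-distrib-+ (c u) (λ v → c v u)) ⟩
    ℕΣ.sum (λ u → ℕΣ.sum (c u) + ℕΣ.sum (λ v → c v u))
      ≡⟨ ℕΣ.∑-distrib-+ (λ u → ℕΣ.sum (c u)) (λ u → ℕΣ.sum (λ v → c v u)) ⟩
    S + ℕΣ.sum (λ u → ℕΣ.sum (λ v → c v u))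
      ≡⟨ cong (S +_) (ℕΣ.∑-comm (λ u v → c v u)) ⟩
    S + S
      ≡⟨ sym (cong₂ _+_ (size≡sum M) (size≡sum M)) ⟩
    matchingSize G M + matchingSize G M
      ∎
    where
    open ≡-Reasoning
    c = counted M
    S = ℕΣ.sum (λ u → ℕΣ.sum (c u))

  size-compare : ∀ {M M′} → IsMatching G M → IsMatching G M′ → (f g : Fin n → ℕ) →
                 (∀ t → degree M′ t + f t ≡ degree M t + g t) →
                 (matchingSize G M′ + matchingSize G M′) + ℕΣ.sum f ≡
                 (matchingSize G M + matchingSize G M) + ℕΣ.sum g
  size-compare {M} {M′} isM isM′ f g local = begin
    (matchingSize G M′ + matchingSize G M′) + ℕΣ.sum f  ≡⟨ cong (_+ ℕΣ.sum f) (handshake isM′) ⟩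
    ℕΣ.sum (degree M′) + ℕΣ.sum f                       ≡⟨ ℕΣ.∑-distrib-+ (degree M′) f ⟨
    ℕΣ.sum (λ t → degree M′ t + f t)                    ≡⟨ ℕΣ.sum-cong-≗ local ⟩
    ℕΣ.sum (λ t → degree M t + g t)                     ≡⟨ ℕΣ.∑-distrib-+ (degree M) g ⟩
    ℕΣ.sum (degree M) + ℕΣ.sum g                        ≡⟨ cong (_+ ℕΣ.sum g) (handshake isM) ⟨
    (matchingSize G M + matchingSize G M) + ℕΣ.sum g    ∎
    where open ≡-Reasoning

module Rooted {n : ℕ} (G : SimpleGraph n) (conn : Connected G) (r : Fin n) where

  Reach : ℕ → Fin n → Set
  Reach zero    t = t ≡ r
  Reach (suc k) t = Reach k t ⊎ ∃ λ s → Reach k s × Adj G s t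

  reach? : ∀ k → Decidable (Reach k)
  reach? zero    t = t ≟F r
  reach? (suc k) t = reach? k t ⊎-dec any? (λ s → reach? k s ×-dec T? (adj G s t))

  reach-walk : ∀ {P u t} → WalkIn G P u t → ∀ {k} → Reach k u → ∃ λ k′ → Reach k′ t
  reach-walk (here _)         ru = _ , ru
  reach-walk (step _ a walk) ru = reach-walk walk (inj₂ (_ , ru , a))

  private
    depthData : ∀ t → Σ ℕ λ k → Reach k t × (∀ {j} → Reach j t → k ≤ j)
    depthData t = leastWitness (λ k → reach? k t) (proj₂ (reach-walk (conn r t) {0} refl))

  depth : Fin n → ℕ
  depth t = proj₁ (depthData t)

  depth-reach : ∀ t → Reach (depth t) t
  depth-reach t = proj₁ (proj₂ (depthData t))

  depth-least : ∀ {t j} → Reach j t → depth t ≤ j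
  depth-least {t} = proj₂ (proj₂ (depthData t))

  depth-root : depth r ≡ 0
  depth-root = ℕP.n≤0⇒n≡0 (depth-least {r} {0} refl)

  depth≡0⇒root : ∀ {t} → depth t ≡ 0 → t ≡ r
  depth≡0⇒root {t} d≡0 = subst (λ k → Reach k t) d≡0 (depth-reach t)

  depth-adj : ∀ {x y} → Adj G x y → depth y ≤ suc (depth x)
  depth-adj {x} a = depth-least (inj₂ (x , depth-reach x , a))

  private
    stepUp : ∀ t d → t ≢ r → Reach d t → (∀ {j} → Reach j t → d ≤ j) →
             Σ (Fin n) λ s → Adj G s t × suc (depth s) ≡ d
    stepUp t zero    t≢r t≡r        _     = contradiction t≡r t≢r
    stepUp t (suc k) t≢r (inj₁ rk)  least = contradiction (least rk) (ℕP.n≮n k)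
    stepUp t (suc k) t≢r (inj₂ (s , rs , a)) least =
      s , a , cong suc (ℕP.≤-antisym (depth-least rs) (ℕP.≤-pred (least (inj₂ (s , depth-reach s , a)))))

    parentData : ∀ t → t ≢ r → Σ (Fin n) λ s → Adj G s t × suc (depth s) ≡ depth t
    parentData t t≢r = stepUp t (depth t) t≢r (depth-reach t) depth-least

  parent : Fin n → Fin n
  parent t with t ≟F r
  ... | yes _   = r
  ... | no t≢r = proj₁ (parentData t t≢r)

  parent-adj : ∀ {t} → t ≢ r → Adj G (parent t) t
  parent-adj {t} t≢r with t ≟F r
  ... | yes t≡r = contradiction t≡r t≢r
  ... | no t≢r′ = proj₁ (proj₂ (parentData t t≢r′))

  parent-depth : ∀ {t} → t ≢ r → suc (depth (parent t)) ≡ depth t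
  parent-depth {t} t≢r with t ≟F r
  ... | yes t≡r = contradiction t≡r t≢r
  ... | no t≢r′ = proj₂ (proj₂ (parentData t t≢r′))

  parent-< : ∀ {t} → t ≢ r → depth (parent t) < depth t
  parent-< t≢r = ℕP.≤-reflexive (parent-depth t≢r)

  root-or-below : ∀ {p} {P : Fin n → Set p} → P r → (∀ {t} → t ≢ r → P t) → ∀ t → P t
  root-or-below at-root below t with t ≟F r
  ... | yes refl = at-root
  ... | no t≢r  = below t≢r

  depth≡suc⇒nonroot : ∀ {t k} → depth t ≡ suc k → t ≢ r
  depth≡suc⇒nonroot {t} d≡suc refl with trans (sym d≡suc) depth-root
  ... | ()

-- In a tree every edge joins a vertex to its parent; the two ways this
-- could fail (an edge inside one layer, or a second neighbour one layer
-- up) would each close a cycle through the parents.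
module RootedTree {n : ℕ} (G : SimpleGraph n) (conn : Connected G) (acyc : Acyclic G)
                  (r : Fin n) where
  open Rooted G conn r public

  _ChildOf_ : Fin n → Fin n → Set
  c ChildOf t = c ≢ r × parent c ≡ t

  child-depth : ∀ {c t} → c ChildOf t → depth c ≡ suc (depth t)
  child-depth (c≢r , refl) = sym (parent-depth c≢r)

  child-adj : ∀ {c t} → c ChildOf t → Adj G t c
  child-adj (c≢r , refl) = parent-adj c≢r

  parent-layer : ∀ {t d} → depth t ≡ suc d → depth (parent t) ≡ d
  parent-layer d≡ = ℕP.suc-injective (trans (parent-depth (depth≡suc⇒nonroot d≡)) d≡)

  record Detour (d : ℕ) (p q : Fin n) : Set where
    field
      rest   : List (Fin n)
      unique : Unique (p ∷ (parent p ∷ rest) ++ q ∷ [])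
      linked : Linked (Adj G) (p ∷ (parent p ∷ rest) ++ q ∷ [])
      above  : All (λ t → depth t < d) (parent p ∷ rest)

  private
    below⇒≢ : ∀ {d a} xs → depth a ≡ d → All (λ t → depth t < d) xs → All (a ≢_) xs
    below⇒≢ []       _   []          = []
    below⇒≢ (x ∷ xs) a≡d (x<d ∷ xs<d) =
      (λ { refl → ℕP.<-irrefl a≡d x<d }) ∷ below⇒≢ xs a≡d xs<d

    bracket : ∀ {d} p q xs → depth p ≡ d → depth q ≡ d → p ≢ q →
              Unique xs → All (λ t → depth t < d) xs → Unique (p ∷ xs ++ q ∷ [])
    bracket p q xs p≡d q≡d p≢q u xs<d = all-++ (below⇒≢ xs p≡d xs<d) (p≢q ∷ []) ∷ snoc xs u xs<d
      where
      snoc : ∀ xs → Unique xs → All (λ t → depth t < _) xs → Unique (xs ++ q ∷ [])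
      snoc []       _        _           = [] ∷ []
      snoc (x ∷ xs) (x∉ ∷ u) (x<d ∷ xs<d) =
        all-++ x∉ ((λ { refl → ℕP.<-irrefl q≡d x<d }) ∷ []) ∷ snoc xs u xs<d

  detour : ∀ d p q → depth p ≡ d → depth q ≡ d → p ≢ q → Detour d p q
  detour zero p q p≡0 q≡0 p≢q = contradiction (trans (depth≡0⇒root p≡0) (sym (depth≡0⇒root q≡0))) p≢q
  detour (suc d) p q p≡ q≡ p≢q with parent p ≟F parent q
  ... | yes pp≡pq = record
    { rest   = []
    ; unique = bracket p q _ p≡ q≡ p≢q ([] ∷ []) (pp<d ∷ [])
    ; linked = adj-sym′ G (parent-adj p≢r) ∷ subst (λ z → Adj G z q) (sym pp≡pq) (parent-adj q≢r) ∷ [-]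
    ; above  = pp<d ∷ [] }
    where
    p≢r = depth≡suc⇒nonroot p≡
    q≢r = depth≡suc⇒nonroot q≡
    pp<d : depth (parent p) < suc d
    pp<d = ℕP.≤-reflexive (cong suc (parent-layer p≡))
  ... | no pp≢pq = record
    { rest   = (parent (parent p) ∷ Detour.rest D) ++ parent q ∷ []
    ; unique = bracket p q _ p≡ q≡ p≢q (Detour.unique D) inner<d
    ; linked = linked-snoc (adj-sym′ G (parent-adj p≢r) ∷ Detour.linked D)
                 (subst (λ z → Adj G z q) (sym (lastOf-snoc (parent p) (parent (parent p) ∷ Detour.rest D) (parent q)))
                        (parent-adj q≢r))
    ; above  = inner<d }
    where
    p≢r = depth≡suc⇒nonroot p≡
    q≢r = depth≡suc⇒nonroot q≡
    D = detour d (parent p) (parent q) (parent-layer p≡) (parent-layer q≡) pp≢pq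
    inner<d : All (λ t → depth t < suc d) (parent p ∷ (parent (parent p) ∷ Detour.rest D) ++ parent q ∷ [])
    inner<d = ℕP.≤-reflexive (cong suc (parent-layer p≡))
            ∷ all-++ (all-map ℕP.m<n⇒m<1+n (Detour.above D)) (ℕP.≤-reflexive (cong suc (parent-layer q≡)) ∷ [])

  -- an edge inside one layer closes the cycle x, parent x, …, y, x
  no-layer-edge : ∀ {x y} → Adj G x y → depth x ≢ depth y
  no-layer-edge {x} {y} a x≡y =
    acyc x ((parent x ∷ rest) ++ y ∷ []) (s≤s (length-++-≤ʳ (y ∷ []) {rest})) unique
      (linked-snoc linked (subst (λ z → Adj G z x) (sym (lastOf-snoc x (parent x ∷ rest) y)) (adj-sym′ G a)))
    where open Detour (detour (depth x) x y refl (sym x≡y) (adj⇒≢ G a))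

  -- a neighbour x one layer above y is the parent of y; otherwise
  -- y, parent y, …, x, y would be a cycle
  upper-neighbour : ∀ {x y} → Adj G x y → depth y ≡ suc (depth x) → parent y ≡ x
  upper-neighbour {x} {y} a y≡ with parent y ≟F x
  ... | yes py≡x  = py≡x
  ... | no py≢x = ⊥-elim $ acyc y cycle (s≤s (s≤s z≤n)) (below⇒≢ cycle y≡ on-cycle ∷ unique)
                    (linked-snoc (adj-sym′ G (parent-adj y≢r) ∷ linked)
                       (subst (λ z → Adj G z y) (sym (lastOf-snoc (parent y) (parent (parent y) ∷ rest) x)) a))
    where
    y≢r = depth≡suc⇒nonroot y≡
    open Detour (detour (depth x) (parent y) x (parent-layer y≡) refl py≢x)
    cycle = parent y ∷ (parent (parent y) ∷ rest) ++ x ∷ []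
    on-cycle : All (λ t → depth t < suc (depth x)) cycle
    on-cycle = ℕP.≤-reflexive (cong suc (parent-layer y≡))
             ∷ all-++ (all-map ℕP.m<n⇒m<1+n above) (ℕP.n<1+n _ ∷ [])

  tree-edge : ∀ {x y} → Adj G x y → x ChildOf y ⊎ y ChildOf x
  tree-edge {x} {y} a with ℕP.<-cmp (depth x) (depth y)
  ... | tri≈ _ x≡y _ = contradiction x≡y (no-layer-edge a)
  ... | tri< x<y _ _ = inj₂ (depth≡suc⇒nonroot y≡ , upper-neighbour a y≡)
    where y≡ = ℕP.≤-antisym (depth-adj a) x<y
  ... | tri> _ _ y<x = inj₁ (depth≡suc⇒nonroot x≡ , upper-neighbour (adj-sym′ G a) x≡)
    where x≡ = ℕP.≤-antisym (depth-adj (adj-sym′ G a)) y<x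

  data _≼_ : Fin n → Fin n → Set where
    self : ∀ {q} → q ≼ q
    up   : ∀ {t q} → q ≢ r → t ≼ parent q → t ≼ q

  parent-≼ : ∀ {t} → t ≢ r → parent t ≼ t
  parent-≼ t≢r = up t≢r self

  ≼-trans : ∀ {t s q} → t ≼ s → s ≼ q → t ≼ q
  ≼-trans t≼s self          = t≼s
  ≼-trans t≼s (up q≢r s≼pq) = up q≢r (≼-trans t≼s s≼pq)

  ≼-depth : ∀ {t q} → t ≼ q → depth t ≤ depth q
  ≼-depth self          = ℕP.≤-refl
  ≼-depth (up q≢r t≼pq) = ℕP.≤-trans (≼-depth t≼pq) (ℕP.<⇒≤ (parent-< q≢r))

  ≼-layer : ∀ {t q} → t ≼ q → depth t ≡ depth q → t ≡ q
  ≼-layer self          _ = refl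
  ≼-layer (up q≢r t≼pq) t≡q = contradiction t≡q (ℕP.<⇒≢ (ℕP.≤-<-trans (≼-depth t≼pq) (parent-< q≢r)))

  ≼-unique : ∀ {t t′ q} → t ≼ q → t′ ≼ q → depth t ≡ depth t′ → t ≡ t′
  ≼-unique self          t′≼q        t≡t′ = sym (≼-layer t′≼q (sym t≡t′))
  ≼-unique (up q≢r t≼pq) self        t≡t′ = ≼-layer (up q≢r t≼pq) t≡t′
  ≼-unique (up _ t≼pq)   (up _ t′≼pq) t≡t′ = ≼-unique t≼pq t′≼pq t≡t′

  ≼-root : ∀ {t} → t ≼ r → t ≡ r
  ≼-root {t} t≼r = depth≡0⇒root (ℕP.n≤0⇒n≡0 (subst (depth t ≤_) depth-root (≼-depth t≼r)))

  root-≼ : ∀ q → r ≼ q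
  root-≼ q = go (depth q) q refl
    where
    go : ∀ k q → depth q ≡ k → r ≼ q
    go zero    q q≡0 = subst (r ≼_) (sym (depth≡0⇒root q≡0)) self
    go (suc k) q q≡  = up (depth≡suc⇒nonroot q≡) (go k (parent q) (parent-layer q≡))

  ≼-inv : ∀ {t q} → t ≼ q → t ≢ q → q ≢ r × t ≼ parent q
  ≼-inv self           t≢q = contradiction refl t≢q
  ≼-inv (up q≢r t≼pq) _   = q≢r , t≼pq

  path-child : ∀ {t q} → t ≼ q → t ≢ q → ∃ λ c → c ChildOf t × c ≼ q
  path-child self t≢q = contradiction refl t≢q
  path-child {t} {q} (up q≢r t≼pq) _ with t ≟F parent q
  ... | yes refl = q , (q≢r , refl) , self
  ... | no t≢pq with path-child t≼pq t≢pq
  ...   | c , c-child , c≼pq = c , c-child , up q≢r c≼pq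

  path-child-unique : ∀ {t c c′ q} → c ChildOf t → c ≼ q → c′ ChildOf t → c′ ≼ q → c ≡ c′
  path-child-unique c-child c≼q c′-child c′≼q =
    ≼-unique c≼q c′≼q (trans (child-depth c-child) (sym (child-depth c′-child)))

  _≼?_ : ∀ t q → Dec (t ≼ q)
  t ≼? q = go (depth q) q refl
    where
    go : ∀ k q → depth q ≡ k → Dec (t ≼ q)
    go k q q≡ with t ≟F q | q ≟F r
    ... | yes refl | _        = yes self
    ... | no t≢q   | yes refl = no (λ t≼r → t≢q (≼-root t≼r))
    go zero    q q≡ | no _   | no q≢r = contradiction (depth≡0⇒root q≡) q≢r
    go (suc k) q q≡ | no t≢q | no q≢r with go k (parent q) (parent-layer q≡)
    ... | yes t≼pq = yes (up q≢r t≼pq)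
    ... | no  t⋠pq = no (λ t≼q → t⋠pq (proj₂ (≼-inv t≼q t≢q)))

  child-≼ : ∀ {c t} → c ChildOf t → t ≼ c
  child-≼ (c≢r , refl) = parent-≼ c≢r

  above-child : ∀ {u c t} → c ChildOf t → u ≼ c → u ≢ c → u ≼ t
  above-child (_ , refl) u≼c u≢c = proj₂ (≼-inv u≼c u≢c)

  child-⋠ : ∀ {c t} → c ChildOf t → ¬ c ≼ t
  child-⋠ {c} {t} c-child c≼t = ℕP.<-irrefl refl (subst (_≤ depth t) (child-depth c-child) (≼-depth c≼t))

  parent≢child : ∀ {t d} → t ≢ r → d ChildOf t → parent t ≢ d
  parent≢child {t} t≢r d-child refl =
    ℕP.<-irrefl refl (ℕP.<-trans (ℕP.n<1+n _) (subst (_< depth t) (child-depth d-child) (parent-< t≢r)))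

  MatchedDown : (Fin n → Fin n → Bool) → Fin n → Fin n → Set
  MatchedDown M q t = ∃ λ c → c ChildOf t × c ≼ q × T (M t c)

  Alternating : (Fin n → Fin n → Bool) → Fin n → Set
  Alternating M q = ∀ {t} → t ≢ r → t ≼ q → t ≢ q → T (M t (parent t)) ⊎ MatchedDown M q t

-- When q is
-- exposed and the path alternates, every vertex other than r keeps at most
-- one partner and only q gains one; at the root the flip either augments N
-- (r exposed) or shifts its exposed vertex from q to r (r matched down).
module PathFlip {n : ℕ} (G : SimpleGraph n) (conn : Connected G) (acyc : Acyclic G) (r : Fin n)
                {N : Fin n → Fin n → Bool} (isM : IsMatching G N) (q : Fin n) (q≢r : q ≢ r) where
  open RootedTree G conn acyc r
  open Matchings G

  OnPath : Fin n → Set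
  OnPath t = t ≢ r × t ≼ q

  PathEdge : Fin n → Fin n → Set
  PathEdge x y = (OnPath x × parent x ≡ y) ⊎ (OnPath y × parent y ≡ x)

  pathEdge? : ∀ x y → Dec (PathEdge x y)
  pathEdge? x y = (onPath? x ×-dec (parent x ≟F y)) ⊎-dec (onPath? y ×-dec (parent y ≟F x))
    where
    onPath? : ∀ t → Dec (OnPath t)
    onPath? t = ¬? (t ≟F r) ×-dec (t ≼? q)

  path : Fin n → Fin n → Bool
  path x y = does (pathEdge? x y)

  flipped : Fin n → Fin n → Bool
  flipped x y = N x y xor path x y

  swap-edge : ∀ {x y} → PathEdge x y → PathEdge y x
  swap-edge (inj₁ e) = inj₂ e
  swap-edge (inj₂ e) = inj₁ e

  path-sym : ∀ x y → path x y ≡ path y x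
  path-sym x y with pathEdge? x y
  ... | yes e  = trans (dec-true (pathEdge? x y) e) (sym (dec-true (pathEdge? y x) (swap-edge e)))
  ... | no ¬e = trans (dec-false (pathEdge? x y) ¬e) (sym (dec-false (pathEdge? y x) (¬e ∘ swap-edge)))

  path-adj : ∀ {x y} → T (path x y) → Adj G x y
  path-adj {x} {y} e with does-sound (pathEdge? x y) e
  ... | inj₁ ((x≢r , _) , refl) = adj-sym′ G (parent-adj x≢r)
  ... | inj₂ ((y≢r , _) , refl) = parent-adj y≢r

  path-off : ∀ {t} → ¬ t ≼ q → EmptyRow path t
  path-off {t} t⋠q j = dec-false (pathEdge? t j) λ
    { (inj₁ ((_ , t≼q) , _))        → t⋠q t≼q
    ; (inj₂ ((j≢r , j≼q) , refl)) → t⋠q (≼-trans (parent-≼ j≢r) j≼q) }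

  path-end : PartnerRow path q (parent q)
  path-end j with j ≟F parent q
  ... | yes refl = dec-true (pathEdge? q j) (inj₁ ((q≢r , self) , refl))
  ... | no j≢pq = dec-false (pathEdge? q j) λ
    { (inj₁ (_ , pq≡j))             → j≢pq (sym pq≡j)
    ; (inj₂ ((j≢r , j≼q) , pj≡q)) → child-⋠ (j≢r , pj≡q) j≼q }

  path-inner : ∀ {t d} → OnPath t → d ChildOf t → d ≼ q → ∀ j → path t j ≡ (δ j (parent t) ∨ δ j d)
  path-inner {t} {d} t-on d-child d≼q j with j ≟F parent t
  ... | yes refl = dec-true (pathEdge? t j) (inj₁ (t-on , refl))
  ... | no j≢pt with j ≟F d
  ...   | yes refl = dec-true (pathEdge? t j) (inj₂ ((proj₁ d-child , d≼q) , proj₂ d-child))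
  ...   | no j≢d   = dec-false (pathEdge? t j) λ
    { (inj₁ (_ , pt≡j))             → j≢pt (sym pt≡j)
    ; (inj₂ ((j≢r , j≼q) , pj≡t)) → j≢d (path-child-unique (j≢r , pj≡t) j≼q d-child d≼q) }

  private
    first : ∃ λ d → d ChildOf r × d ≼ q
    first = path-child (root-≼ q) (q≢r ∘ sym)

  d₀ : Fin n
  d₀ = proj₁ first

  d₀-child : d₀ ChildOf r
  d₀-child = proj₁ (proj₂ first)

  d₀≼q : d₀ ≼ q
  d₀≼q = proj₂ (proj₂ first)

  path-start : PartnerRow path r d₀
  path-start j with j ≟F d₀
  ... | yes refl = dec-true (pathEdge? r j) (inj₂ ((proj₁ d₀-child , d₀≼q) , proj₂ d₀-child))
  ... | no j≢d₀  = dec-false (pathEdge? r j) λ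
    { (inj₁ ((r≢r , _) , _))        → r≢r refl
    ; (inj₂ ((j≢r , j≼q) , pj≡r)) → j≢d₀ (path-child-unique (j≢r , pj≡r) j≼q d₀-child d₀≼q) }

  record FlipAt (t : Fin n) : Set where
    field
      degree-flip : degree flipped t ≡ degree N t + count (δ t q)
      single      : ∀ {j j′} → T (flipped t j) → T (flipped t j′) → j ≡ j′

  exchange-at : ∀ {t p p′} → t ≢ q → PartnerRow N t p′ → PartnerRow flipped t p → FlipAt t
  exchange-at {t} t≢q N-row flip-row = record
    { degree-flip = trans (degree-partner flipped t flip-row)
                          (sym (cong₂ _+_ (degree-partner N t N-row) (cong count (δ-other t≢q))))
    ; single      = partner-unique flipped t flip-row }

  module _ (q-exposed : ∀ j → ¬ T (N q j)) (alt : Alternating N q) where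

    flip-at-end : FlipAt q
    flip-at-end = record
      { degree-flip = trans (degree-partner flipped q flip-row)
                            (sym (cong₂ _+_ (degree-empty N q (exposed-row {N} q-exposed)) (cong count (δ-self q))))
      ; single      = partner-unique flipped q flip-row }
      where
      flip-row : PartnerRow flipped q (parent q)
      flip-row j = trans (cong (_xor path q j) (exposed-row {N} q-exposed j)) (path-end j)

    flip-at-off : ∀ {t} → ¬ t ≼ q → FlipAt t
    flip-at-off {t} t⋠q = record
      { degree-flip = trans (ℕΣ.sum-cong-≗ {n} (λ j → cong count (unchanged j)))
                            (sym (trans (cong (degree N t +_) (cong count (δ-other t≢q))) (ℕP.+-identityʳ _)))
      ; single      = λ {j} {j′} tj tj′ →
          IsMatching.disj isM t j j′ (subst T (unchanged j) tj) (subst T (unchanged j′) tj′) }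
      where
      unchanged : ∀ j → flipped t j ≡ N t j
      unchanged j = trans (cong (N t j xor_) (path-off t⋠q j)) (xor-identityʳ (N t j))
      t≢q : t ≢ q
      t≢q refl = t⋠q self

    flip-at-inner : ∀ {t} → t ≢ r → t ≼ q → t ≢ q → FlipAt t
    flip-at-inner {t} t≢r t≼q t≢q with path-child t≼q t≢q | alt t≢r t≼q t≢q
    ... | d , d-child , d≼q | inj₁ to-parent =
      exchange-at t≢q (matched-row isM to-parent) λ j →
        trans (cong₂ _xor_ (matched-row isM to-parent j) (path-inner (t≢r , t≼q) d-child d≼q j))
              (xor-exchange (parent≢child t≢r d-child) j)
    ... | d , d-child , d≼q | inj₂ (c , c-child , c≼q , to-child) rewrite path-child-unique c-child c≼q d-child d≼q =
      exchange-at t≢q (matched-row isM to-child) λ j →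
        trans (cong₂ _xor_ (matched-row isM to-child j) (path-inner (t≢r , t≼q) d-child d≼q j))
              (xor-exchange′ (parent≢child t≢r d-child) j)

    flip-at : ∀ {t} → t ≢ r → FlipAt t
    flip-at {t} t≢r with t ≟F q | t ≼? q
    ... | yes refl | _        = flip-at-end
    ... | no t≢q   | yes t≼q = flip-at-inner t≢r t≼q t≢q
    ... | no _     | no t⋠q  = flip-at-off t⋠q

    flip-matching : (∀ {j j′} → T (flipped r j) → T (flipped r j′) → j ≡ j′) → IsMatching G flipped
    flip-matching root-single = record
      { sub  = λ x y e → [ IsMatching.sub isM x y , path-adj ]′ (xor-split e)
      ; sym  = λ x y → cong₂ _xor_ (IsMatching.sym isM x y) (path-sym x y)
      ; disj = λ t j j′ → single-at t }
      where
      xor-split : ∀ {x y} → T (flipped x y) → T (N x y) ⊎ T (path x y)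
      xor-split {x} {y} with N x y
      ... | true  = λ _ → inj₁ tt
      ... | false = inj₂
      single-at : ∀ t {j j′} → T (flipped t j) → T (flipped t j′) → j ≡ j′
      single-at = root-or-below root-single (λ t≢r → FlipAt.single (flip-at t≢r))

    augment : (∀ j → ¬ T (N r j)) → IsMatching G flipped × matchingSize G flipped ≡ suc (matchingSize G N)
    augment r-exposed = isM′ , double-injective _ _ (begin
      s′ + s′                     ≡⟨ ℕP.+-identityʳ _ ⟨
      s′ + s′ + 0                 ≡⟨ cong (s′ + s′ +_) (ℕSparse.sum-zero {n} (λ _ → 0) (λ _ → refl)) ⟨
      s′ + s′ + ℕΣ.sum {n} (λ _ → 0) ≡⟨ size-compare isM isM′ (λ _ → 0) g local ⟩
      s + s + ℕΣ.sum g            ≡⟨ cong (s + s +_) (trans (ℕΣ.∑-distrib-+ (λ t → count (δ t q)) _)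
                                                           (cong₂ _+_ (sum-δ q) (sum-δ r))) ⟩
      s + s + 2                   ≡⟨ ℕP.+-comm (s + s) 2 ⟩
      suc (suc (s + s))           ≡⟨ cong suc (ℕP.+-suc s s) ⟨
      suc s + suc s               ∎)
      where
      open ≡-Reasoning
      s  = matchingSize G N
      s′ = matchingSize G flipped
      root-row : PartnerRow flipped r d₀
      root-row j = trans (cong (_xor path r j) (exposed-row {N} r-exposed j)) (path-start j)
      isM′ : IsMatching G flipped
      isM′ = flip-matching (partner-unique flipped r root-row)
      g : Fin n → ℕ
      g t = count (δ t q) + count (δ t r)
      local : ∀ t → degree flipped t + 0 ≡ degree N t + g t
      local = root-or-below
        (begin
          degree flipped r + 0         ≡⟨ cong (_+ 0) (degree-partner flipped r root-row) ⟩
          1                            ≡⟨ cong count (δ-self r) ⟨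
          count (δ r r)                ≡⟨ cong₂ (λ a b → a + (count b + count (δ r r)))
                                                (degree-empty N r (exposed-row {N} r-exposed)) (δ-other (q≢r ∘ sym)) ⟨
          degree N r + (count (δ r q) + count (δ r r)) ∎)
        (λ {t} t≢r → begin
          degree flipped t + 0         ≡⟨ ℕP.+-identityʳ _ ⟩
          degree flipped t             ≡⟨ FlipAt.degree-flip (flip-at t≢r) ⟩
          degree N t + count (δ t q)   ≡⟨ cong (degree N t +_) (ℕP.+-identityʳ _) ⟨
          degree N t + (count (δ t q) + 0) ≡⟨ cong (λ b → degree N t + (count (δ t q) + count b)) (δ-other t≢r) ⟨
          degree N t + g t             ∎)

    shift : MatchedDown N q r →
            IsMatching G flipped × matchingSize G flipped ≡ matchingSize G N × (∀ j → ¬ T (flipped r j))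
    shift (c , c-child , c≼q , r-c) = isM′ , double-injective _ _ (ℕP.+-cancelʳ-≡ 1 _ _ (begin
      s′ + s′ + 1                          ≡⟨ cong (s′ + s′ +_) (sum-δ r) ⟨
      s′ + s′ + ℕΣ.sum (λ t → count (δ t r)) ≡⟨ size-compare isM isM′ _ _ local ⟩
      s + s + ℕΣ.sum (λ t → count (δ t q))   ≡⟨ cong (s + s +_) (sum-δ q) ⟩
      s + s + 1                            ∎)) , root-exposed
      where
      open ≡-Reasoning
      s  = matchingSize G N
      s′ = matchingSize G flipped
      N-root : PartnerRow N r d₀
      N-root = subst (PartnerRow N r) (path-child-unique c-child c≼q d₀-child d₀≼q) (matched-row isM r-c)
      root-row : EmptyRow flipped r
      root-row j = trans (cong₂ _xor_ (N-root j) (path-start j)) (xor-same (δ j d₀))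
      root-exposed : ∀ j → ¬ T (flipped r j)
      root-exposed j = subst T (root-row j)
      isM′ : IsMatching G flipped
      isM′ = flip-matching (λ {j} e → contradiction e (root-exposed j))
      local : ∀ t → degree flipped t + count (δ t r) ≡ degree N t + count (δ t q)
      local = root-or-below
        (begin
          degree flipped r + count (δ r r)
            ≡⟨ cong₂ (λ a b → a + count b) (degree-empty flipped r root-row) (δ-self r) ⟩
          1
            ≡⟨ cong₂ (λ a b → a + count b) (degree-partner N r N-root) (δ-other (q≢r ∘ sym)) ⟨
          degree N r + count (δ r q)        ∎)
        (λ {t} t≢r → begin
          degree flipped t + count (δ t r)  ≡⟨ cong (λ b → degree flipped t + count b) (δ-other t≢r) ⟩
          degree flipped t + 0              ≡⟨ ℕP.+-identityʳ _ ⟩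
          degree flipped t                  ≡⟨ FlipAt.degree-flip (flip-at t≢r) ⟩
          degree N t + count (δ t q)        ∎)

-- Phases of the vertices of a tree seen from an exposed root along
-- alternating paths: an `even σ` vertex is reached by an alternating path
-- of length 2k with σ recording the sign (-1)^k, an `odd σ` vertex by one
-- of length 2k + 1 ending in a non-matching edge, and an `off` vertex by none.
data Phase : Set where
  even odd : Bool → Phase
  off      : Phase

advance : Phase → Bool → Phase
advance (even σ) false = odd σ
advance (even σ) true  = off
advance (odd σ)  true  = even (not σ)
advance (odd σ)  false = off
advance off      _     = off

value : Phase → ℚ
value (even true)  = 1ℚ
value (even false) = -ℚ 1ℚ
value (odd _)      = 0ℚ
value off          = 0ℚ

value-cancel : ∀ σ → value (even σ) +ℚ value (even (not σ)) ≡ 0ℚ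
value-cancel true  = ℚP.+-inverseʳ 1ℚ
value-cancel false = ℚP.+-inverseˡ 1ℚ

value-after-even : ∀ σ b → value (advance (even σ) b) ≡ 0ℚ
value-after-even σ true  = refl
value-after-even σ false = refl

advance-even : ∀ ph b {σ} → advance ph b ≡ even σ → ∃ λ σ′ → ph ≡ odd σ′ × b ≡ true
advance-even (odd σ′) true _ = σ′ , refl , refl
advance-even (even _) true  ()
advance-even (even _) false ()
advance-even (odd _)  false ()
advance-even off      _     ()

advance-odd : ∀ ph b {σ} → advance ph b ≡ odd σ → ph ≡ even σ × b ≡ false
advance-odd (even σ) false refl = refl , refl
advance-odd (even _) true  ()
advance-odd (odd _)  true  ()
advance-odd (odd _)  false ()
advance-odd off      _     ()

odd≢off : ∀ {σ} → odd σ ≢ off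
odd≢off ()

advance-off : ∀ ph b → advance ph b ≢ off → ph ≢ off
advance-off off _ live refl = live refl

odd-continues : ∀ σ b → advance (odd σ) b ≢ off → b ≡ true
odd-continues σ true  _    = refl
odd-continues σ false live = contradiction refl live

even-stops : ∀ σ b → advance (even σ) b ≡ off → b ≡ true
even-stops σ true  _ = refl
even-stops σ false ()

module ExposedRoot {n : ℕ} (G : SimpleGraph n) (conn : Connected G) (acyc : Acyclic G) (r : Fin n)
                   {N : Fin n → Fin n → Bool} (isM : IsMatching G N) (r-exposed : ∀ j → ¬ T (N r j))
                   (maximum : ∀ M′ → IsMatching G M′ → matchingSize G M′ ≤ matchingSize G N) where
  open RootedTree G conn acyc r

  phaseAt : ℕ → Fin n → Phase
  phaseAt zero    t = even true
  phaseAt (suc k) t = advance (phaseAt k (parent t)) (N (parent t) t)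

  phase : Fin n → Phase
  phase t = phaseAt (depth t) t

  phase-root : phase r ≡ even true
  phase-root = cong (λ k → phaseAt k r) depth-root

  phase-child : ∀ {c t} → c ChildOf t → phase c ≡ advance (phase t) (N t c)
  phase-child (c≢r , refl) = cong (λ k → phaseAt k _) (sym (parent-depth c≢r))

  root≢odd : ∀ {s σ} → phase s ≡ odd σ → s ≢ r
  root≢odd s-odd refl with trans (sym phase-root) s-odd
  ... | ()

  live-above : ∀ {t s} → t ≼ s → phase s ≢ off → phase t ≢ off
  live-above self          live = live
  live-above (up s≢r t≼ps) live = live-above t≼ps (advance-off _ _ (live ∘ trans (phase-child (s≢r , refl))))

  alternating : ∀ {s} → phase s ≢ off → Alternating N s
  alternating {s} live {t} t≢r t≼s t≢s with phase t in t-phase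
  ... | off = contradiction t-phase (live-above t≼s live)
  ... | even σ with advance-even _ _ (trans (sym (phase-child (t≢r , refl))) t-phase)
  ...   | _ , _ , matched = inj₁ (matched-sym G isM (subst T (sym matched) tt))
  alternating {s} live {t} t≢r t≼s t≢s | odd σ with path-child t≼s t≢s
  ... | c , c-child , c≼s = inj₂ (c , c-child , c≼s , subst T (sym (odd-continues σ (N t c) c-live)) tt)
    where
    c-live : advance (odd σ) (N t c) ≢ off
    c-live = subst (_≢ off) (trans (phase-child c-child) (cong (λ ph → advance ph (N t c)) t-phase)) (live-above c≼s live)

  -- odd vertices are matched: otherwise their root path would augment N
  odd-matched : ∀ {s σ} → phase s ≡ odd σ → ∃ λ m → T (N s m)
  odd-matched {s} s-odd with any? (λ m → T? (N s m))
  ... | yes found = found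
  ... | no none   = contradiction (subst (_≤ matchingSize G N) size′ (maximum flipped isM′)) (ℕP.n≮n _)
    where
    open PathFlip G conn acyc r isM s (root≢odd s-odd)
    augmented : IsMatching G flipped × matchingSize G flipped ≡ suc (matchingSize G N)
    augmented = augment (λ j m → none (j , m)) (alternating (odd≢off ∘ trans (sym s-odd))) r-exposed
    isM′ : IsMatching G flipped
    isM′ = proj₁ augmented
    size′ : matchingSize G flipped ≡ suc (matchingSize G N)
    size′ = proj₂ augmented

  x : Fin n → ℚ
  x t = value (phase t)

  open AdjacencyRows G x

  x-parent-of-even : ∀ {s σ} → s ≢ r → phase s ≡ even σ → x (parent s) ≡ 0ℚ
  x-parent-of-even s≢r s-even with advance-even _ _ (trans (sym (phase-child (s≢r , refl))) s-even)
  ... | _ , p-odd , _ = cong value p-odd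

  null-even : ∀ {s σ} → phase s ≡ even σ → rowSum s ≡ 0ℚ
  null-even {s} {σ} s-even = row-zero s vanish
    where
    vanish : ∀ j → Adj G s j → x j ≡ 0ℚ
    vanish j a with tree-edge a
    ... | inj₁ (s≢r , refl) = x-parent-of-even s≢r s-even
    ... | inj₂ j-child      =
      trans (cong value (trans (phase-child j-child) (cong (λ ph → advance ph (N s j)) s-even))) (value-after-even σ (N s j))

  -- an off vertex has no even neighbour: an even parent would be matched to
  -- it and also to its own parent (or be the exposed root)
  null-off : ∀ {s} → phase s ≡ off → rowSum s ≡ 0ℚ
  null-off {s} s-off = row-zero s vanish
    where
    vanish : ∀ j → Adj G s j → x j ≡ 0ℚ
    vanish j a with tree-edge a
    ... | inj₂ j-child = cong value (trans (phase-child j-child) (cong (λ ph → advance ph (N s j)) s-off))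
    ... | inj₁ s-child@(s≢r , refl) with phase j in j-phase
    ...   | odd _  = refl
    ...   | off    = refl
    ...   | even σ = ⊥-elim (two-partners (j ≟F r))
      where
      j-s : T (N j s)
      j-s = subst T (sym (even-stops σ _ (trans (sym (cong (λ ph → advance ph (N j s)) j-phase))
                                                  (trans (sym (phase-child s-child)) s-off)))) tt
      two-partners : Dec (j ≡ r) → ⊥
      two-partners (yes j≡r) = r-exposed s (subst (λ z → T (N z s)) j≡r j-s)
      two-partners (no j≢r) with advance-even _ _ (trans (sym (phase-child (j≢r , refl))) j-phase)
      ... | _ , _ , matched = parent≢child j≢r s-child
          (IsMatching.disj isM j (parent j) s (matched-sym G isM (subst T (sym matched) tt)) j-s)

  -- an odd vertex sees exactly its even parent and its even partner, of
  -- opposite signs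
  null-odd : ∀ {s σ} → phase s ≡ odd σ → rowSum s ≡ 0ℚ
  null-odd {s} {σ} s-odd with odd-matched s-odd
  ... | m , s-m = begin
    rowSum s                 ≡⟨ row-pair p≢m (adj-sym′ G (parent-adj s≢r)) (IsMatching.sub isM s m s-m) vanish ⟩
    x (parent s) +ℚ x m      ≡⟨ cong₂ (λ a b → value a +ℚ value b) p-even m-even ⟩
    value (even σ) +ℚ value (even (not σ)) ≡⟨ value-cancel σ ⟩
    0ℚ                       ∎
    where
    open ≡-Reasoning
    s≢r : s ≢ r
    s≢r = root≢odd s-odd
    from-parent : phase (parent s) ≡ even σ × N (parent s) s ≡ false
    from-parent = advance-odd _ _ (trans (sym (phase-child (s≢r , refl))) s-odd)
    p-even : phase (parent s) ≡ even σ
    p-even = proj₁ from-parent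
    p≢m : parent s ≢ m
    p≢m refl = subst T (proj₂ from-parent) (matched-sym G isM s-m)
    m-child : m ChildOf s
    m-child with tree-edge (IsMatching.sub isM s m s-m)
    ... | inj₁ (_ , ps≡m) = contradiction ps≡m p≢m
    ... | inj₂ m-child    = m-child
    m-even : phase m ≡ even (not σ)
    m-even = trans (phase-child m-child) (cong₂ advance s-odd (T⇒≡true s-m))
    vanish : ∀ j → j ≢ parent s → j ≢ m → Adj G s j → x j ≡ 0ℚ
    vanish j j≢p j≢m a with tree-edge a
    ... | inj₁ (_ , ps≡j) = contradiction (sym ps≡j) j≢p
    ... | inj₂ j-child    = cong value (trans (phase-child j-child) (cong₂ advance s-odd s-j))
      where
      s-j : N s j ≡ false
      s-j = ¬T⇒≡false (λ e → j≢m (IsMatching.disj isM s j m e s-m))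

  null : InNullSpace G x
  null s with phase s in s-phase
  ... | even _ = null-even s-phase
  ... | odd _  = null-odd s-phase
  ... | off    = null-off s-phase

  root-support : Supp G r
  root-support = x , null , λ x-r → ℚP.1≢0 (trans (cong value (sym phase-root)) x-r)

-- Rooting the tree at b and using a null vector x
-- with x w ≠ 0, descend from w two levels at a time along M-alternating
-- paths, keeping x ≠ 0, until an exposed vertex e is reached; shifting M
-- along the b–e path then gives a maximum matching that leaves b exposed.
module SupportTransfer {n : ℕ} (G : SimpleGraph n) (conn : Connected G) (acyc : Acyclic G) (b : Fin n)
                       {M : Fin n → Fin n → Bool} (isM : IsMatching G M)
                       (maximum : ∀ M′ → IsMatching G M′ → matchingSize G M′ ≤ matchingSize G M)
                       {a w : Fin n} (a-b : T (M a b)) (w-a : Adj G w a) (w≢b : w ≢ b)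
                       (x : Fin n → ℚ) (x-null : InNullSpace G x) (x-w : x w ≢ 0ℚ) where
  open RootedTree G conn acyc b
  open AdjacencyRows G x

  record Stage (s : Fin n) : Set where
    field
      nonroot    : s ≢ b
      nonzero    : x s ≢ 0ℚ
      not-up     : ¬ T (M s (parent s))
      alternates : Alternating M s
      root-down  : MatchedDown M s b

  a-child : a ChildOf b
  a-child with tree-edge (IsMatching.sub isM a b a-b)
  ... | inj₁ a-child       = a-child
  ... | inj₂ (b≢b , _) = contradiction refl b≢b

  w-child : w ChildOf a
  w-child with tree-edge w-a
  ... | inj₁ w-child     = w-child
  ... | inj₂ (_ , pa≡w) = contradiction (trans (sym pa≡w) (proj₂ a-child)) w≢b

  initial : Stage w
  initial = record
    { nonroot    = w≢b
    ; nonzero    = x-w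
    ; not-up     = λ w-pw → w≢b (IsMatching.disj isM a w b
                                   (matched-sym G isM (subst (λ z → T (M w z)) (proj₂ w-child) w-pw)) a-b)
    ; alternates = alternates
    ; root-down  = a , a-child , child-≼ w-child , matched-sym G isM a-b }
    where
    -- the only inner vertex of the path b, a, w is a, matched to its parent b
    alternates : Alternating M w
    alternates {t} t≢b t≼w t≢w with t ≟F a
    ... | yes refl = inj₁ (subst (λ z → T (M a z)) (sym (proj₂ a-child)) a-b)
    ... | no t≢a   = contradiction (≼-root (above-child a-child (above-child w-child t≼w t≢w) t≢a)) t≢b

  matched-child : ∀ {s m} → Stage s → T (M s m) → m ChildOf s
  matched-child {s} {m} st s-m with tree-edge (IsMatching.sub isM s m s-m)
  ... | inj₁ (_ , ps≡m) = contradiction (subst (λ z → T (M s z)) (sym ps≡m) s-m) (Stage.not-up st)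
  ... | inj₂ m-child    = m-child

  -- the null equation at s₁ = x s + Σ_{other neighbours j} x j forces a
  -- neighbour s₂ ≠ s of s₁ with x s₂ ≠ 0
  next-nonzero : ∀ {s s₁} → s₁ ChildOf s → x s ≢ 0ℚ →
                 ∃ λ s₂ → s₂ ≢ s × Adj G s₁ s₂ × x s₂ ≢ 0ℚ
  next-nonzero {s} {s₁} s₁-child x-s
    with any? (λ j → ¬? (j ≟F s) ×-dec T? (adj G s₁ j) ×-dec ¬? (x j ℚP.≟ 0ℚ))
  ... | yes found = found
  ... | no none   = contradiction (trans (sym (row-single (adj-sym′ G (child-adj s₁-child)) vanish)) (x-null s₁)) x-s
    where
    vanish : ∀ j → j ≢ s → Adj G s₁ j → x j ≡ 0ℚ
    vanish j j≢s a with x j ℚP.≟ 0ℚ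
    ... | yes x≡0 = x≡0
    ... | no x≢0  = contradiction (j , j≢s , a , x≢0) none

  two-down : ∀ {s s₁} → Stage s → T (M s s₁) → ∃ λ s₂ → Stage s₂ × depth s₂ ≡ suc (suc (depth s))
  two-down {s} {s₁} st s-s₁ with next-nonzero (matched-child st s-s₁) (Stage.nonzero st)
  ... | s₂ , s₂≢s , s₁-s₂ , x-s₂ =
    s₂ , stage₂ , trans (child-depth s₂-child) (cong suc (child-depth s₁-child))
    where
    s₁-child : s₁ ChildOf s
    s₁-child = matched-child st s-s₁
    s₂-child : s₂ ChildOf s₁
    s₂-child with tree-edge s₁-s₂
    ... | inj₁ (_ , ps₁≡s₂) = contradiction (trans (sym ps₁≡s₂) (proj₂ s₁-child)) s₂≢s
    ... | inj₂ s₂-child     = s₂-child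
    s≼s₂ : s ≼ s₂
    s≼s₂ = ≼-trans (child-≼ s₁-child) (child-≼ s₂-child)
    extend : ∀ {t} → MatchedDown M s t → MatchedDown M s₂ t
    extend (c , c-child , c≼s , t-c) = c , c-child , ≼-trans c≼s s≼s₂ , t-c
    -- the new inner vertices are s (matched down to s₁) and s₁ (matched up to s)
    alternates : Alternating M s₂
    alternates {t} t≢b t≼s₂ t≢s₂ with t ≟F s₁ | t ≟F s
    ... | yes refl | _        = inj₁ (subst (λ z → T (M s₁ z)) (sym (proj₂ s₁-child)) (matched-sym G isM s-s₁))
    ... | no _     | yes refl = inj₂ (s₁ , s₁-child , child-≼ s₂-child , s-s₁)
    ... | no t≢s₁  | no t≢s   =
      map₂ extend (Stage.alternates st t≢b (above-child s₁-child (above-child s₂-child t≼s₂ t≢s₂) t≢s₁) t≢s)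
    stage₂ : Stage s₂
    stage₂ = record
      { nonroot    = proj₁ s₂-child
      ; nonzero    = x-s₂
      ; not-up     = λ s₂-up → s₂≢s (IsMatching.disj isM s₁ s₂ s
                        (matched-sym G isM (subst (λ z → T (M s₂ z)) (proj₂ s₂-child) s₂-up))
                        (matched-sym G isM s-s₁))
      ; alternates = alternates
      ; root-down  = extend (Stage.root-down st) }

  descend : ∀ k {s} → bound depth ≤ depth s + k → Stage s → ∃ λ e → Stage e × (∀ j → ¬ T (M e j))
  descend k {s} room st with any? (λ m → T? (M s m))
  ... | no none = s , st , λ j s-j → none (j , s-j)
  ... | yes (m , s-m) with two-down st s-m | k
  ...   | s₂ , st₂ , deeper | zero   = contradiction (ℕP.≤-trans (bound-≥ depth s₂) room) too-deep
    where
    too-deep : ¬ depth s₂ ≤ depth s + 0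
    too-deep le = ℕP.<-irrefl refl (ℕP.≤-trans (subst (suc (depth s) ≤_) (sym deeper) (ℕP.n≤1+n _))
                                                (ℕP.≤-trans le (ℕP.≤-reflexive (ℕP.+-identityʳ _))))
  ...   | s₂ , st₂ , deeper | suc k′ = descend k′ room′ st₂
    where
    room′ : bound depth ≤ depth s₂ + k′
    room′ = ℕP.≤-trans room (ℕP.≤-trans (ℕP.≤-reflexive (ℕP.+-suc (depth s) k′))
                                        (subst (λ d → suc (depth s + k′) ≤ d + k′) (sym deeper) (ℕP.n≤1+n _)))

  b-support : Supp G b
  b-support with descend (bound depth) (ℕP.m≤n+m _ _) initial
  ... | e , st , e-exposed with PathFlip.shift G conn acyc b isM e (Stage.nonroot st) e-exposed
                                  (Stage.alternates st) (Stage.root-down st)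
  ...   | isM′ , same-size , b-exposed =
    ExposedRoot.root-support G conn acyc b isM′ b-exposed
      (λ M″ isM″ → subst (matchingSize G M″ ≤_) (sym same-size) (maximum M″ isM″))

edge-in-component : ∀ {n} (G : SimpleGraph n) {P : Fin n → Set} {u v} →
                    P u → P v → Adj G u v → EdgeOfSomeComponent G P u v
edge-in-component G {u = u} pu pv u~v = u , pu , here pu , step pu u~v (here pv) , u~v

matched-closure : ∀ {n} (G : SimpleGraph n) → IsTree G → ∀ {M} → IsMaximumMatching G M →
                  ∀ {a b} → T (M a b) → NSupp G a → NSupp G b
matched-closure G _ (isM , _) {a} {b} a-b (inj₁ a-supp) = inj₂ (a , a-supp , IsMatching.sub isM a b a-b)
matched-closure G (_ , conn , acyc) (isM , maximum) {a} {b} a-b (inj₂ (w , (x , x-null , x-w) , w-a))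
  with w ≟F b
... | yes refl = inj₁ (x , x-null , x-w)
... | no w≢b  = inj₁ (SupportTransfer.b-support G conn acyc b isM maximum a-b w-a w≢b x x-null x-w)

mainTheorem4 : (n : ℕ) (G : SimpleGraph n) → IsTree G →
               (M : Fin n → Fin n → Bool) → IsMaximumMatching G M →
               ∀ u v → T (M u v) → ¬ ConnE G u v
mainTheorem4 n G tree M maxM u v u-v (u~v , ¬in-FS , ¬in-FN) =
  ¬in-FN (edge-in-component G u-outside v-outside u~v)
  where
  both-inside : NSupp G u → NSupp G v → ⊥
  both-inside u-in v-in = ¬in-FS (edge-in-component G u-in v-in u~v)
  u-outside : ¬ NSupp G u
  u-outside u-in = both-inside u-in (matched-closure G tree maxM u-v u-in)
  v-outside : ¬ NSupp G v
  v-outside v-in = both-inside (matched-closure G tree maxM (matched-sym G (proj₁ maxM) u-v) v-in) v-in
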